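{- Let $S$ be a set and $\to\subseteq S\times S$ a binary relation. Let $P,P',Q,Q'\subseteq S\times S$, $F_0,F_1,F_2\subseteq S\times S$ and $c_0,c_1,c_2:S\to\mathbb{N}$. For $G,H\subseteq S\times S$ write $G\otimes H=\{((s_0,s_1),(s_0',s_1'))\mid (s_0,s_0')\in G\wedge(s_1,s_1')\in H\}$. If $\mathrm{Ensures2}_{\to}(P,Q,F_0\otimes F_1,c_0,c_1)$ and $\mathrm{Ensures2}_{\to}(P',Q',F_1\otimes F_2,c_1,c_2)$ hold, then $\mathrm{Ensures2}_{\to}(P\circ P',Q\circ Q',F_0\otimes F_2,c_0,c_2)$ holds, where for $A,B\subseteq S\times S$, $A\circ B=\{(x,z)\mid\exists y.\ (x,y)\in A\wedge(y,z)\in B\}$.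
   Context: For $n\in\mathbb{N}$, $\to^n$ denotes the $n$-fold composition of $\to$, with $\to^0$ the identity relation on $S$. For $n\in\mathbb{N}$ and $Q\subseteq S$, $\mathrm{EvN}_{\to}(n,Q)=\{s\in S\mid (\forall s'.\ s\to^n s'\Rightarrow s'\in Q)\wedge(\forall s'\,\forall l<n.\ s\to^l s'\Rightarrow\exists s''.\ s'\to s'')\}$. For $P,Q\subseteq S\times S$, $F\subseteq(S\times S)\times(S\times S)$ and $c_0,c_1:S\to\mathbb{N}$, $\mathrm{Ensures2}_{\to}(P,Q,F,c_0,c_1)$ means: for all $(s_0,s_1)\in P$, $s_0\in\mathrm{EvN}_{\to}\big(c_0(s_0),\{s_0'\mid s_1\in\mathrm{EvN}_{\to}(c_1(s_1),\{s_1'\mid (s_0',s_1')\in Q\wedge((s_0,s_1),(s_0',s_1'))\in F\})\}\big)$. -}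

module Defs where

open import Data.Nat using (ℕ; zero; suc; _<_)
open import Data.Product using (_×_; _,_; ∃)
open import Relation.Binary.PropositionalEquality using (_≡_)

Iter : {S : Set} → (S → S → Set) → ℕ → S → S → Set
Iter _⟶_ zero s t = s ≡ t
Iter _⟶_ (suc n) s t = ∃ λ u → (s ⟶ u) × Iter _⟶_ n u t

EvN : {S : Set} → (S → S → Set) → ℕ → (S → Set) → S → Set
EvN {S} _⟶_ n Q s =
  (∀ s' → Iter _⟶_ n s s' → Q s') ×
  (∀ s' l → l < n → Iter _⟶_ l s s' → ∃ λ s'' → s' ⟶ s'')

Ensures2 : {S : Set} → (S → S → Set) →
           (S × S → Set) → (S × S → Set) → (S × S → S × S → Set) →
           (S → ℕ) → (S → ℕ) → Set
Ensures2 {S} _⟶_ P Q F c₀ c₁ =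
  ∀ s₀ s₁ → P (s₀ , s₁) →
  EvN _⟶_ (c₀ s₀)
    (λ s₀' → EvN _⟶_ (c₁ s₁)
       (λ s₁' → Q (s₀' , s₁') × F (s₀ , s₁) (s₀' , s₁')) s₁)
    s₀

_⊗_ : {S : Set} → (S → S → Set) → (S → S → Set) → (S × S → S × S → Set)
(G ⊗ H) (s₀ , s₁) (s₀' , s₁') = G s₀ s₀' × H s₁ s₁'

_∘ʳ_ : {S : Set} → (S × S → Set) → (S × S → Set) → (S × S → Set)
(A ∘ʳ B) (x , z) = ∃ λ y → A (x , y) × B (y , z)

{-# OPTIONS --safe #-}
module Submission where

-- Given (s₀ , s₁) ∈ P and (s₁ , s₂) ∈ P', fix a c₀-step run of s₀ ending in s₀'.
-- The first hypothesis says s₁ cannot get stuck within c₁ s₁ steps, so it has an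
-- actual run of that length, ending in some s₁' with (s₀' , s₁') ∈ Q and F₀ s₀ s₀'.
-- Feeding this same run of s₁ into the second hypothesis controls every c₂-step run
-- of s₂, and s₁' is the intermediate state witnessing both compositions.

open import Defs
open import Data.Nat using (ℕ; zero; suc; _≤_)
open import Data.Nat.Properties using (≤-refl; <⇒≤)
open import Data.Product using (_×_; _,_; ∃; proj₁; proj₂)
open import Relation.Binary.PropositionalEquality using (refl)

module _ {S : Set} {_⟶_ : S → S → Set} where

  Iter-snoc : ∀ {n s t u} → Iter _⟶_ n s t → t ⟶ u → Iter _⟶_ (suc n) s u
  Iter-snoc {zero}  refl             step = _ , step , refl
  Iter-snoc {suc n} (v , first , run) step = v , first , Iter-snoc run step

  EvN-map : ∀ {n s} {Q Q′ : S → Set} → (∀ {t} → Q t → Q′ t) →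
            EvN _⟶_ n Q s → EvN _⟶_ n Q′ s
  EvN-map f (reach , progress) = (λ t run → f (reach t run)) , progress

  EvN⇒run : ∀ {n s} {Q : S → Set} → EvN _⟶_ n Q s →
            ∀ k → k ≤ n → ∃ λ t → Iter _⟶_ k s t
  EvN⇒run ev zero    _   = _ , refl
  EvN⇒run ev (suc k) k<n with EvN⇒run ev k (<⇒≤ k<n)
  ... | t , run with proj₂ ev t k k<n run
  ... | u , step = u , Iter-snoc run step

  EvN⇒reachable : ∀ {n s} {Q : S → Set} → EvN _⟶_ n Q s →
                  ∃ λ t → Iter _⟶_ n s t × Q t
  EvN⇒reachable {n} {s} ev with EvN⇒run ev n ≤-refl
  ... | t , run = t , run , proj₁ ev t run

lemma4 : {S : Set} (_⟶_ : S → S → Set)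
         (P P' Q Q' : S × S → Set) (F₀ F₁ F₂ : S → S → Set)
         (c₀ c₁ c₂ : S → ℕ) →
         Ensures2 _⟶_ P Q (F₀ ⊗ F₁) c₀ c₁ →
         Ensures2 _⟶_ P' Q' (F₁ ⊗ F₂) c₁ c₂ →
         Ensures2 _⟶_ (P ∘ʳ P') (Q ∘ʳ Q') (F₀ ⊗ F₂) c₀ c₂
lemma4 _⟶_ _ _ Q Q' F₀ F₁ F₂ _ c₁ c₂ ensures₀₁ ensures₁₂ s₀ s₂ (s₁ , p , p') =
  EvN-map (λ {s₀'} → continue s₀') (ensures₀₁ s₀ s₁ p)
  where
  continue : ∀ s₀' →
             EvN _⟶_ (c₁ s₁) (λ s₁' → Q (s₀' , s₁') × (F₀ ⊗ F₁) (s₀ , s₁) (s₀' , s₁')) s₁ →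
             EvN _⟶_ (c₂ s₂) (λ s₂' → (Q ∘ʳ Q') (s₀' , s₂') × (F₀ ⊗ F₂) (s₀ , s₂) (s₀' , s₂')) s₂
  continue s₀' ev₁ with EvN⇒reachable ev₁
  ... | s₁' , run₁ , q , f₀ , _ =
    EvN-map (λ { (q' , _ , f₂) → (s₁' , q , q') , f₀ , f₂ })
            (proj₁ (ensures₁₂ s₁ s₂ p') s₁' run₁)
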